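{- Let $v$ and $w$ be fully commutative permutations such that $w = v s_i$ with $\ell(w) = \ell(v) + 1$. Then $P(v) \neq P(w)$ if and only if every longest increasing subsequence of $v$ uses both $v(i)$ and $v(i+1)$. In particular, when $P(v) \neq P(w)$, we have $|\mathrm{Row}_2(P(w))| = |\mathrm{Row}_2(P(v))| + 1$.
   Context: A permutation is fully commutative iff it avoids $321$. $s_i$ swaps $i$ and $i+1$, so $vs_i$ swaps the entries of $v$ in positions $i,i+1$; $\ell$ is Coxeter length (number of inversions). $P(w)$ is the RSK insertion tableau of $w$, and $\mathrm{Row}_2(P(w))$ is the set of entries in its second row. -}

module Defs where

open import Data.Nat using (ℕ; zero; suc; _+_; _<_; _>_; _<ᵇ_)
open import Data.Nat.Properties using (_<?_)
open import Data.Bool using (if_then_else_)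
open import Data.Maybe using (Maybe; just; nothing)
open import Data.Product using (_×_; _,_; ∃)
open import Data.List using (List; []; _∷_; _∷ʳ_; length; filter; upTo; foldl)
open import Data.List.Relation.Binary.Permutation.Propositional using (_↭_)
open import Data.List.Relation.Binary.Sublist.Propositional using (_⊆_)
open import Data.List.Relation.Unary.Linked using (Linked)
open import Relation.Nullary using (¬_)

-- Permutations in one-line notation, 0-based: a permutation of [n] is a
-- list that is a rearrangement of 0,1,...,n-1 (n = its length).
IsPerm : List ℕ → Set
IsPerm v = v ↭ upTo (length v)

-- entry at (0-based) position i; only used with i < length v
_!_ : List ℕ → ℕ → ℕ
[] ! _ = 0
(x ∷ xs) ! zero = x
(x ∷ xs) ! suc i = xs ! i

-- v s_i : swap the entries in (0-based) positions i and i+1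
swapAt : ℕ → List ℕ → List ℕ
swapAt zero (x ∷ y ∷ xs) = y ∷ x ∷ xs
swapAt zero xs = xs
swapAt (suc i) [] = []
swapAt (suc i) (x ∷ xs) = x ∷ swapAt i xs

-- Coxeter length = number of inversions
len : List ℕ → ℕ
len [] = 0
len (x ∷ xs) = length (filter (λ y → y <? x) xs) + len xs

-- subsequences are sublists; entries of a permutation are distinct, so
-- a subsequence "uses v(i)" iff the value v(i) occurs in it.
Pattern321 : List ℕ → Set
Pattern321 v = ∃ λ a → ∃ λ b → ∃ λ c → (a ∷ b ∷ c ∷ []) ⊆ v × a > b × b > c

FullyCommutative : List ℕ → Set
FullyCommutative v = ¬ Pattern321 v

IncSubseq : List ℕ → List ℕ → Set
IncSubseq s v = s ⊆ v × Linked _<_ s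

LongestIncSubseq : List ℕ → List ℕ → Set
LongestIncSubseq s v = IncSubseq s v × (∀ t → IncSubseq t v → length t Data.Nat.≤ length s)

-- RSK row insertion (Schensted).  A tableau is its list of rows, top first.
Tableau : Set
Tableau = List (List ℕ)

rowInsert : ℕ → List ℕ → List ℕ × Maybe ℕ
rowInsert x [] = x ∷ [] , nothing
rowInsert x (y ∷ ys) with x <ᵇ y
... | Data.Bool.true = x ∷ ys , just y
... | Data.Bool.false with rowInsert x ys
...   | r , b = y ∷ r , b

insertT : ℕ → Tableau → Tableau
insertT x [] = (x ∷ []) ∷ []
insertT x (r ∷ rs) with rowInsert x r
... | r' , nothing = r' ∷ rs
... | r' , just y = r' ∷ insertT y rs

P : List ℕ → Tableau
P w = foldl (λ T x → insertT x T) [] w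

Row₂ : Tableau → List ℕ
Row₂ (_ ∷ r ∷ _) = r
Row₂ _ = []

module Submission where

-- For a 321-avoiding word with distinct entries, Schensted insertion never creates a third
-- row: an entry bumped out of the first row exceeds every entry bumped before it, since a
-- smaller one would complete a 321 pattern. So the second row is the list of bumped entries,
-- and by Schensted's theorem the first row is as long as a longest increasing subsequence.
--
-- Let v = α a b β and w = α b a β with a < b. After reading α a b and α b a, the two states
-- are either equal, or v's first row has one extra entry e which sits in w's second row; this
-- relation survives the insertion of β. In the first case P v = P w, and a longest increasing
-- subsequence of w, which cannot use both b and a, is also one of v. In the second case v's
-- first row is longer, so every longest increasing subsequence of v uses both a and b (else
-- it would be an increasing subsequence of w), and w's second row is one entry longer.

open import Defs
open import Data.Bool using (true; false)
open import Data.Bool.Properties using (T-≡)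
open import Data.Empty using (⊥; ⊥-elim)
open import Data.List using (List; []; _∷_; _∷ʳ_; _++_; [_]; length; filter; foldl; initLast; _∷ʳ′_)
open import Data.List.Membership.Propositional using (_∈_; _∉_)
open import Data.List.Membership.Propositional.Properties using (∈-++⁺ˡ; ∈-++⁺ʳ)
open import Data.List.Properties
  using (++-assoc; ++-identityʳ; length-++; length-++-sucʳ; foldl-++; ∷-injective; ∷-injectiveˡ; ∷ʳ-injective;
         filter-++; length-filter; filter-all; filter-none; filter-accept; filter-reject)
open import Data.List.Relation.Binary.Permutation.Propositional using (↭-refl; ↭-swap; ↭-sym; ↭⇒↭ₛ)
open import Data.List.Relation.Binary.Permutation.Propositional.Properties using (↭-length; filter-↭; ++⁺ˡ)
open import Data.List.Relation.Binary.Sublist.Propositional using (_⊆_; []; _∷_; ⊆-refl; ⊆-trans; minimum; from∈; lookup) renaming (_∷ʳ_ to skip)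
open import Data.List.Relation.Binary.Sublist.Propositional.Properties using (++⁺; ++⁺ʳ)
open import Data.List.Relation.Unary.All as All using (All; []; _∷_)
import Data.List.Relation.Unary.All.Properties as All
open import Data.List.Relation.Unary.AllPairs as AllPairs using (AllPairs; []; _∷_)
import Data.List.Relation.Unary.AllPairs.Properties as AllPairs
open import Data.List.Relation.Unary.Any using (here; there)
open import Data.List.Relation.Unary.Linked as Linked using (Linked; []; [-])
open import Data.List.Relation.Unary.Linked.Properties using (AllPairs⇒Linked; Linked⇒AllPairs)
open import Data.List.Relation.Unary.Unique.Propositional using (Unique)
open import Data.List.Relation.Unary.Unique.Propositional.Properties using (upTo⁺)
open import Data.Maybe using (Maybe; just; nothing)
open import Data.Nat using (ℕ; zero; suc; _+_; _⊔_; _<_; _≤_; _<ᵇ_; z≤n; s≤s)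
open import Data.Nat.Properties
open import Algebra.Properties.CommutativeSemigroup +-commutativeSemigroup using (x∙yz≈y∙xz)
open import Data.Product using (_×_; _,_; ∃-syntax; proj₁; proj₂; map₁; map₂)
open import Data.Sum using (_⊎_; inj₁; inj₂)
open import Function using (_∘_)
open import Function.Bundles using (Equivalence; _⇔_; mk⇔)
open import Relation.Binary.PropositionalEquality using (_≡_; _≢_; refl; sym; trans; cong; cong₂; subst; subst₂; setoid; module ≡-Reasoning)
open import Relation.Nullary using (¬_; yes; no)
open import Relation.Nullary.Reflects using (ofʸ; ofⁿ)
open import Data.List.Relation.Binary.Permutation.Setoid.Properties (setoid ℕ) using (Unique-resp-↭)

private
  variable
    A : Set
    x y : ℕ
    xs ys : List ℕ

-- Lists and increasing subsequences

Sorted : List ℕ → Set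
Sorted = AllPairs _<_

AllPairs-++⁻ : ∀ {R : A → A → Set} (xs : List A) {ys} → AllPairs R (xs ++ ys) →
               AllPairs R xs × AllPairs R ys × All (λ x → All (R x) ys) xs
AllPairs-++⁻ [] ps = [] , ps , []
AllPairs-++⁻ (x ∷ xs) (p ∷ ps) with AllPairs-++⁻ xs ps
... | pxs , pys , pxys = All.++⁻ˡ xs p ∷ pxs , pys , All.++⁻ʳ xs p ∷ pxys

Sorted-∷ʳ⁻ : ∀ xs → Sorted (xs ∷ʳ y) → Sorted xs × All (_< y) xs
Sorted-∷ʳ⁻ xs s with AllPairs-++⁻ xs s
... | sxs , _ , lt = sxs , All.map All.head lt

Sorted-∷ʳ⁺ : Sorted xs → All (_< y) xs → Sorted (xs ∷ʳ y)
Sorted-∷ʳ⁺ s lt = AllPairs.++⁺ s ([] ∷ []) (All.map (_∷ []) lt)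

Sorted-above : ∀ xs {ys} → Sorted (xs ++ y ∷ ys) → All (y <_) ys
Sorted-above xs s with AllPairs-++⁻ xs s
... | _ , (p ∷ _) , _ = p

Sorted-below : ∀ xs {ys} → Sorted (xs ++ y ∷ ys) → All (_< y) xs
Sorted-below xs s with AllPairs-++⁻ xs s
... | _ , _ , lt = All.map All.head lt

Sorted-replace : ∀ xs {ys} → Sorted (xs ++ y ∷ ys) → All (_< x) xs → x < y → Sorted (xs ++ x ∷ ys)
Sorted-replace xs s xs<x x<y with AllPairs-++⁻ xs s
... | sxs , (y<ys ∷ sys) , xs<y∷ys =
  AllPairs.++⁺ sxs (All.map (<-trans x<y) y<ys ∷ sys)
    (All.map (λ (z<x , z<y∷ys) → z<x ∷ All.tail z<y∷ys) (All.zip (xs<x , xs<y∷ys)))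

length-∷ʳ : ∀ (xs : List A) {x} → length (xs ∷ʳ x) ≡ suc (length xs)
length-∷ʳ xs = trans (length-++ xs) (+-comm (length xs) 1)

++-∷-split : ∀ (a₁ : List A) {u a₂} b₁ {z b₂} → a₁ ++ u ∷ a₂ ≡ b₁ ++ z ∷ b₂ →
  (a₁ ≡ b₁ × u ≡ z × a₂ ≡ b₂)
  ⊎ (∃[ m ] a₁ ≡ b₁ ++ z ∷ m × b₂ ≡ m ++ u ∷ a₂)
  ⊎ (∃[ m ] b₁ ≡ a₁ ++ u ∷ m × a₂ ≡ m ++ z ∷ b₂)
++-∷-split [] [] eq with ∷-injective eq
... | u≡z , a₂≡b₂ = inj₁ (refl , u≡z , a₂≡b₂)
++-∷-split [] (w ∷ b₁) eq with ∷-injective eq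
... | refl , e = inj₂ (inj₂ (b₁ , refl , e))
++-∷-split (w ∷ a₁) [] eq with ∷-injective eq
... | refl , e = inj₂ (inj₁ (a₁ , refl , sym e))
++-∷-split (w ∷ a₁) (w′ ∷ b₁) eq with ∷-injective eq
... | refl , e with ++-∷-split a₁ b₁ e
...   | inj₁ (e₁ , e₂ , e₃) = inj₁ (cong (w ∷_) e₁ , e₂ , e₃)
...   | inj₂ (inj₁ (m , e₁ , e₂)) = inj₂ (inj₁ (m , cong (w ∷_) e₁ , e₂))
...   | inj₂ (inj₂ (m , e₁ , e₂)) = inj₂ (inj₂ (m , cong (w ∷_) e₁ , e₂))

++-∷-nonempty : ∀ (xs : List A) {x ys} → [] ≢ xs ++ x ∷ ys
++-∷-nonempty [] ()
++-∷-nonempty (_ ∷ _) ()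

⊆-∷ʳ⁻ : ∀ {t} d → t ⊆ d ∷ʳ x → t ⊆ d ⊎ ∃[ t₀ ] t ≡ t₀ ∷ʳ x × t₀ ⊆ d
⊆-∷ʳ⁻ [] (skip _ []) = inj₁ []
⊆-∷ʳ⁻ [] (refl ∷ []) = inj₂ ([] , refl , [])
⊆-∷ʳ⁻ (y ∷ d) (skip .y p) with ⊆-∷ʳ⁻ d p
... | inj₁ q = inj₁ (skip y q)
... | inj₂ (t₀ , e , q) = inj₂ (t₀ , e , skip y q)
⊆-∷ʳ⁻ (y ∷ d) (refl ∷ p) with ⊆-∷ʳ⁻ d p
... | inj₁ q = inj₁ (refl ∷ q)
... | inj₂ (t₀ , e , q) = inj₂ (y ∷ t₀ , cong (y ∷_) e , refl ∷ q)

⊆-unswap : ∀ (α : List A) {a b} β {t} → t ⊆ α ++ a ∷ b ∷ β →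
           (∃[ t₁ ] ∃[ t₂ ] t ≡ t₁ ++ a ∷ b ∷ t₂) ⊎ t ⊆ α ++ b ∷ a ∷ β
⊆-unswap (x ∷ α) β (skip .x p) with ⊆-unswap α β p
... | inj₁ split = inj₁ split
... | inj₂ q = inj₂ (skip x q)
⊆-unswap (x ∷ α) β (refl ∷ p) with ⊆-unswap α β p
... | inj₁ (t₁ , t₂ , refl) = inj₁ (x ∷ t₁ , t₂ , refl)
... | inj₂ q = inj₂ (refl ∷ q)
⊆-unswap [] {a} {b} β (skip .a (skip .b q)) = inj₂ (skip b (skip a q))
⊆-unswap [] {a} {b} β (skip .a (refl ∷ q)) = inj₂ (refl ∷ skip a q)
⊆-unswap [] {a} {b} β (refl ∷ skip .b q) = inj₂ (skip b (refl ∷ q))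
⊆-unswap [] β {_ ∷ _ ∷ t₂} (refl ∷ refl ∷ _) = inj₁ ([] , t₂ , refl)

Linked⇒Sorted : Linked _<_ xs → Sorted xs
Linked⇒Sorted = Linked⇒AllPairs <-trans

IncSubseq-++ʳ : ∀ {t d} e → IncSubseq t d → IncSubseq t (d ++ e)
IncSubseq-++ʳ e (t⊆d , inc) = ++⁺ʳ e t⊆d , inc

IncSubseq-∷ʳ⁺ : ∀ {t d} → IncSubseq t d → All (_< x) t → IncSubseq (t ∷ʳ x) (d ∷ʳ x)
IncSubseq-∷ʳ⁺ (t⊆d , inc) t<x = ++⁺ t⊆d ⊆-refl , AllPairs⇒Linked (Sorted-∷ʳ⁺ (Linked⇒Sorted inc) t<x)

IncSubseq-∷ʳ⁻ : ∀ {t} d → IncSubseq t (d ∷ʳ x) →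
                IncSubseq t d ⊎ ∃[ t₀ ] t ≡ t₀ ∷ʳ x × IncSubseq t₀ d × All (_< x) t₀
IncSubseq-∷ʳ⁻ d (t⊆dx , inc) with ⊆-∷ʳ⁻ d t⊆dx
... | inj₁ t⊆d = inj₁ (t⊆d , inc)
... | inj₂ (t₀ , refl , t₀⊆d) with Sorted-∷ʳ⁻ t₀ (Linked⇒Sorted inc)
...   | sorted , t₀<x = inj₂ (t₀ , refl , (t₀⊆d , AllPairs⇒Linked sorted) , t₀<x)

IncSubseq-unswap : ∀ α {a b} β {t} → a < b → IncSubseq t (α ++ b ∷ a ∷ β) → IncSubseq t (α ++ a ∷ b ∷ β)
IncSubseq-unswap α β a<b (t⊆w , inc) with ⊆-unswap α β t⊆w
... | inj₂ t⊆v = t⊆v , inc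
... | inj₁ (t₁ , t₂ , refl) = ⊥-elim (<-asym a<b (All.head (Sorted-above t₁ (Linked⇒Sorted inc))))

IncSubseq-swapped-exclusive : ∀ α {a b} β {t} → a < b → Unique (α ++ b ∷ a ∷ β) →
                              IncSubseq t (α ++ b ∷ a ∷ β) → a ∈ t → b ∈ t → ⊥
IncSubseq-swapped-exclusive (x ∷ α) β a<b (_ ∷ unique) (skip .x t⊆w , inc) =
  IncSubseq-swapped-exclusive α β a<b unique (t⊆w , inc)
IncSubseq-swapped-exclusive (x ∷ α) β a<b (x∉w ∷ unique) (refl ∷ t⊆w , inc) a∈t b∈t
  with a∈t | b∈t
... | here refl | _ = All.lookup x∉w (∈-++⁺ʳ α (there (here refl))) refl
... | _ | here refl = All.lookup x∉w (∈-++⁺ʳ α (here refl)) refl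
... | there a∈t′ | there b∈t′ = IncSubseq-swapped-exclusive α β a<b unique (t⊆w , Linked.tail inc) a∈t′ b∈t′
IncSubseq-swapped-exclusive [] β a<b (_ ∷ a∉β ∷ _) (skip _ (skip _ t⊆β) , _) a∈t _ =
  All.lookup a∉β (lookup t⊆β a∈t) refl
IncSubseq-swapped-exclusive [] β a<b _ (skip _ (refl ∷ _) , _) _ (here refl) = <-irrefl refl a<b
IncSubseq-swapped-exclusive [] β a<b ((_ ∷ b∉β) ∷ _) (skip _ (refl ∷ t⊆β) , _) _ (there b∈t) =
  All.lookup b∉β (lookup t⊆β b∈t) refl
IncSubseq-swapped-exclusive [] β a<b _ (refl ∷ skip _ _ , _) (here refl) _ = <-irrefl refl a<b
IncSubseq-swapped-exclusive [] β a<b (_ ∷ a∉β ∷ _) (refl ∷ skip _ t⊆β , _) (there a∈t) _ =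
  All.lookup a∉β (lookup t⊆β a∈t) refl
IncSubseq-swapped-exclusive [] β a<b _ (refl ∷ refl ∷ _ , inc) _ _ = <-asym a<b (Linked.head inc)

-- Counting entries below a bound, and inversions

countBelow : ℕ → List ℕ → ℕ
countBelow c xs = length (filter (_<? c) xs)

countBelow-++ : ∀ c xs ys → countBelow c (xs ++ ys) ≡ countBelow c xs + countBelow c ys
countBelow-++ c xs ys = trans (cong length (filter-++ (_<? c) xs ys)) (length-++ (filter (_<? c) xs))

countBelow≤length : ∀ c xs → countBelow c xs ≤ length xs
countBelow≤length c = length-filter (_<? c)

countBelow-all : ∀ c → All (_< c) xs → countBelow c xs ≡ length xs
countBelow-all c xs<c = cong length (filter-all (_<? c) xs<c)

countBelow-none : ∀ c → All (c ≤_) xs → countBelow c xs ≡ 0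
countBelow-none c c≤xs = cong length (filter-none (_<? c) (All.map ≤⇒≯ c≤xs))

countBelow-accept : ∀ {c} → x < c → countBelow c (x ∷ xs) ≡ suc (countBelow c xs)
countBelow-accept {c = c} x<c = cong length (filter-accept (_<? c) x<c)

countBelow-reject : ∀ {c} → ¬ x < c → countBelow c (x ∷ xs) ≡ countBelow c xs
countBelow-reject {c = c} x≮c = cong length (filter-reject (_<? c) x≮c)

countBelow-∷ : ∀ c x xs → countBelow c xs ≤ countBelow c (x ∷ xs)
countBelow-∷ c x xs = subst (countBelow c xs ≤_) (sym (countBelow-++ c [ x ] xs)) (m≤n+m _ _)

countBelow-++ˡ : ∀ c xs ys → countBelow c xs ≤ countBelow c (xs ++ ys)
countBelow-++ˡ c xs ys = subst (countBelow c xs ≤_) (sym (countBelow-++ c xs ys)) (m≤m+n _ _)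

countBelow-cut : ∀ c xs → All (c ≤_) ys → countBelow c (xs ++ ys) ≤ length xs
countBelow-cut {ys} c xs c≤ys = begin
  countBelow c (xs ++ ys)             ≡⟨ countBelow-++ c xs ys ⟩
  countBelow c xs + countBelow c ys   ≡⟨ cong (countBelow c xs +_) (countBelow-none c c≤ys) ⟩
  countBelow c xs + 0                 ≡⟨ +-identityʳ _ ⟩
  countBelow c xs                     ≤⟨ countBelow≤length c xs ⟩
  length xs                           ∎
  where open ≤-Reasoning

countBelow-through : ∀ c xs ys → All (_< x) xs → x < c → suc (length xs) ≤ countBelow c (xs ++ x ∷ ys)
countBelow-through {x} c xs ys xs<x x<c = begin
  suc (length xs)                   ≡⟨ length-∷ʳ xs ⟨
  length (xs ∷ʳ x)                  ≡⟨ sym (countBelow-all c (All.∷ʳ⁺ (All.map (λ z<x → <-trans z<x x<c) xs<x) x<c)) ⟩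
  countBelow c (xs ∷ʳ x)            ≤⟨ countBelow-++ˡ c (xs ∷ʳ x) ys ⟩
  countBelow c ((xs ∷ʳ x) ++ ys)    ≡⟨ cong (countBelow c) (++-assoc xs [ x ] ys) ⟩
  countBelow c (xs ++ x ∷ ys)       ∎
  where open ≤-Reasoning

countBelow-replace : ∀ c xs ys → x < y → countBelow c (xs ++ y ∷ ys) ≤ countBelow c (xs ++ x ∷ ys)
countBelow-replace {x} {y} c xs ys x<y
  rewrite countBelow-++ c xs (y ∷ ys) | countBelow-++ c xs (x ∷ ys) = +-monoʳ-≤ (countBelow c xs) head-step
  where
  head-step : countBelow c (y ∷ ys) ≤ countBelow c (x ∷ ys)
  head-step with y <? c | x <? c
  ... | yes y<c | yes x<c = ≤-reflexive (trans (countBelow-accept y<c) (sym (countBelow-accept x<c)))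
  ... | yes y<c | no x≮c = ⊥-elim (x≮c (<-trans x<y y<c))
  ... | no y≮c | yes x<c = ≤-trans (≤-reflexive (countBelow-reject y≮c)) (≤-trans (n≤1+n _) (≤-reflexive (sym (countBelow-accept x<c))))
  ... | no y≮c | no x≮c = ≤-reflexive (trans (countBelow-reject y≮c) (sym (countBelow-reject x≮c)))

countBelow-swap : ∀ c α {a b} β → countBelow c (α ++ a ∷ b ∷ β) ≡ countBelow c (α ++ b ∷ a ∷ β)
countBelow-swap c α β = ↭-length (filter-↭ (_<? c) (++⁺ˡ α (↭-swap _ _ ↭-refl)))

len-swap-descent : ∀ α {a b} β → ¬ a < b → len (α ++ b ∷ a ∷ β) ≤ len (α ++ a ∷ b ∷ β)
len-swap-descent [] {a} {b} β a≮b = begin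
  countBelow b (a ∷ β) + (countBelow a β + len β)   ≡⟨ cong (_+ _) (countBelow-reject a≮b) ⟩
  countBelow b β + (countBelow a β + len β)         ≡⟨ x∙yz≈y∙xz (countBelow b β) (countBelow a β) (len β) ⟩
  countBelow a β + (countBelow b β + len β)         ≤⟨ +-monoˡ-≤ _ (countBelow-∷ a b β) ⟩
  countBelow a (b ∷ β) + (countBelow b β + len β)   ∎
  where open ≤-Reasoning
len-swap-descent (x ∷ α) β a≮b = +-mono-≤ (≤-reflexive (countBelow-swap x α β)) (len-swap-descent α β a≮b)

len-swap-ascent : ∀ α {a b} β → len (α ++ b ∷ a ∷ β) ≡ suc (len (α ++ a ∷ b ∷ β)) → a < b
len-swap-ascent α {a} {b} β eq with a <? b
... | yes a<b = a<b
... | no a≮b = ⊥-elim (1+n≰n (subst (_≤ len (α ++ a ∷ b ∷ β)) eq (len-swap-descent α β a≮b)))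

-- Row insertion

<ᵇ-true : x < y → (x <ᵇ y) ≡ true
<ᵇ-true x<y = Equivalence.to T-≡ (<⇒<ᵇ x<y)

<ᵇ-false : y ≤ x → (x <ᵇ y) ≡ false
<ᵇ-false {y} {x} y≤x with x <ᵇ y | <ᵇ-reflects-< x y
... | false | _ = refl
... | true | ofʸ x<y = ⊥-elim (≤⇒≯ y≤x x<y)

data RowInsertion (x : ℕ) (r : List ℕ) : List ℕ × Maybe ℕ → Set where
  appended : All (_≤ x) r → RowInsertion x r (r ∷ʳ x , nothing)
  bumped   : ∀ r₁ y r₂ → r ≡ r₁ ++ y ∷ r₂ → All (_≤ x) r₁ → x < y →
             RowInsertion x r (r₁ ++ x ∷ r₂ , just y)

rowInsertion : ∀ x r → RowInsertion x r (rowInsert x r)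
rowInsertion x [] = appended []
rowInsertion x (y ∷ ys) with x <ᵇ y | <ᵇ-reflects-< x y
... | true | ofʸ x<y = bumped [] y ys refl [] x<y
... | false | ofⁿ x≮y with rowInsert x ys | rowInsertion x ys
...   | _ | appended ys≤x = appended (≮⇒≥ x≮y ∷ ys≤x)
...   | _ | bumped r₁ z r₂ refl r₁≤x x<z = bumped (y ∷ r₁) z r₂ refl (≮⇒≥ x≮y ∷ r₁≤x) x<z

rowInsert-skip : ∀ r₁ {r₂} → All (_≤ x) r₁ → rowInsert x (r₁ ++ r₂) ≡ map₁ (r₁ ++_) (rowInsert x r₂)
rowInsert-skip [] _ = refl
rowInsert-skip {x} (y ∷ r₁) (y≤x ∷ r₁≤x) with x <ᵇ y | <ᵇ-false y≤x
... | false | refl = cong (map₁ (y ∷_)) (rowInsert-skip r₁ r₁≤x)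

rowInsert-append : ∀ {r} → All (_≤ x) r → rowInsert x r ≡ (r ∷ʳ x , nothing)
rowInsert-append {r = r} r≤x = trans (cong (rowInsert _) (sym (++-identityʳ r))) (rowInsert-skip r r≤x)

rowInsert-bump : ∀ r₁ {r₂} → All (_≤ x) r₁ → x < y → rowInsert x (r₁ ++ y ∷ r₂) ≡ (r₁ ++ x ∷ r₂ , just y)
rowInsert-bump r₁ {r₂} r₁≤x x<y = trans (rowInsert-skip r₁ r₁≤x) (cong (map₁ (r₁ ++_)) (bump-head x<y))
  where
  bump-head : x < y → rowInsert x (y ∷ r₂) ≡ (x ∷ r₂ , just y)
  bump-head {x} {y} x<y with x <ᵇ y | <ᵇ-true x<y
  ... | true | refl = refl

rowInsert-bump-++ : ∀ r₁ {r₂ r₁′} → rowInsert x r₁ ≡ (r₁′ , just y) → rowInsert x (r₁ ++ r₂) ≡ (r₁′ ++ r₂ , just y)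
rowInsert-bump-++ [] ()
rowInsert-bump-++ {x} (z ∷ r₁) eq with x <ᵇ z
rowInsert-bump-++ (z ∷ r₁) refl | true = refl
... | false with rowInsert x r₁ in eq′
rowInsert-bump-++ (z ∷ r₁) {r₂} refl | false | r′ , just y rewrite rowInsert-bump-++ r₁ {r₂} eq′ = refl

-- The first row and the entries bumped out of it, in bumping order; for 321-avoiding input
-- the latter is the whole rest of the tableau (see Row₂-toTableau).
State : Set
State = List ℕ × List ℕ

push : List ℕ → Maybe ℕ → List ℕ
push s nothing = s
push s (just y) = s ∷ʳ y

step : State → ℕ → State
step (r , s) x = map₂ (push s) (rowInsert x r)

run : State → List ℕ → State
run = foldl step

toTableau : State → Tableau
toTableau (r , s) = r ∷ P s

insertT-toTableau : ∀ x st → insertT x (toTableau st) ≡ toTableau (step st x)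
insertT-toTableau x (r , s) with rowInsert x r
... | r′ , nothing = refl
... | r′ , just y = cong (r′ ∷_) (sym (foldl-++ (λ T z → insertT z T) [] s [ y ]))

insertAll-toTableau : ∀ xs st → foldl (λ T z → insertT z T) (toTableau st) xs ≡ toTableau (run st xs)
insertAll-toTableau [] st = refl
insertAll-toTableau (x ∷ xs) st rewrite insertT-toTableau x st = insertAll-toTableau xs (step st x)

P-run : ∀ x xs → P (x ∷ xs) ≡ toTableau (run ([] , []) (x ∷ xs))
P-run x xs = insertAll-toTableau xs ([ x ] , [])

run₀ : List ℕ → State
run₀ = run ([] , [])

P-run₀ : ∀ α y ys → P (α ++ y ∷ ys) ≡ toTableau (run₀ (α ++ y ∷ ys))
P-run₀ [] y ys = P-run y ys
P-run₀ (z ∷ α) y ys = P-run z (α ++ y ∷ ys)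

insertAll-sorted : ∀ q s → Sorted (q ++ s) → foldl (λ T z → insertT z T) [ q ] s ≡ [ q ++ s ]
insertAll-sorted q [] _ = cong [_] (sym (++-identityʳ q))
insertAll-sorted q (x ∷ s) sorted with rowInsert x q | rowInsert-append (All.map <⇒≤ (Sorted-below q sorted))
... | _ | refl = trans (insertAll-sorted (q ∷ʳ x) s (subst Sorted (sym (++-assoc q [ x ] s)) sorted))
                       (cong [_] (++-assoc q [ x ] s))

Row₂-toTableau : ∀ r s → Sorted s → Row₂ (toTableau (r , s)) ≡ s
Row₂-toTableau r [] _ = refl
Row₂-toTableau r (z ∷ s) sorted rewrite insertAll-sorted [ z ] s sorted = refl

step-rowInsert : ∀ r s {r′ m} x → rowInsert x r ≡ (r′ , m) → step (r , s) x ≡ (r′ , push s m)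
step-rowInsert r s x eq = cong (map₂ (push s)) eq

push-++ : ∀ s₁ s₂ m → push (s₁ ++ s₂) m ≡ s₁ ++ push s₂ m
push-++ s₁ s₂ nothing = refl
push-++ s₁ s₂ (just y) = ++-assoc s₁ s₂ [ y ]

-- Schensted's theorem for the first row

FullyCommutative-⊆ : ∀ {u v} → u ⊆ v → FullyCommutative v → FullyCommutative u
FullyCommutative-⊆ u⊆v fc (a , b , c , abc⊆u , a>b , b>c) = fc (a , b , c , ⊆-trans abc⊆u u⊆v , a>b , b>c)

Admissible : List ℕ → Set
Admissible w = Unique w × FullyCommutative w

Admissible-++⁻ˡ : ∀ d {e} → Admissible (d ++ e) → Admissible d
Admissible-++⁻ˡ d {e} (unique , fc) = AllPairs-++⁻ d unique .proj₁ , FullyCommutative-⊆ (++⁺ʳ e ⊆-refl) fc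

Admissible-∉ : ∀ d → Admissible (d ∷ʳ x) → x ∉ d
Admissible-∉ d (unique , _) x∈d = All.head (All.lookup (AllPairs-++⁻ d unique .proj₂ .proj₂) x∈d) refl

≤-∉⇒< : ∀ {d r} → All (_≤ x) r → All (_∈ d) r → x ∉ d → All (_< x) r
≤-∉⇒< [] [] _ = []
≤-∉⇒< (z≤x ∷ r≤x) (z∈d ∷ r∈d) x∉d = ≤∧≢⇒< z≤x (λ { refl → x∉d z∈d }) ∷ ≤-∉⇒< r≤x r∈d x∉d

Admissible-reassoc : ∀ d e xs → Admissible (d ++ e ++ xs) → Admissible ((d ++ e) ++ xs)
Admissible-reassoc d e xs = subst Admissible (sym (++-assoc d e xs))

prefix-below-descent : ∀ α {a b} β → a < b → FullyCommutative (α ++ b ∷ a ∷ β) → ∀ {z} → z ∈ α → z ≤ b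
prefix-below-descent α {a} {b} β a<b fc {z} z∈α with z ≤? b
... | yes z≤b = z≤b
... | no z≰b = ⊥-elim (fc (z , b , a , ++⁺ (from∈ z∈α) (refl ∷ refl ∷ minimum β) , ≰⇒> z≰b , a<b))

-- Together these say that the first row is as long as a longest increasing subsequence of d.
LisBound : List ℕ → List ℕ → Set
LisBound d r = ∀ t c → IncSubseq t d → All (_< c) t → length t ≤ countBelow c r

LisWitness : List ℕ → List ℕ → Set
LisWitness d r = ∀ r₁ z r₂ → r ≡ r₁ ++ z ∷ r₂ → ∃[ t ] IncSubseq t d × length t ≡ suc (length r₁) × All (_≤ z) t

LisBound-append : ∀ {d r} → LisBound d r → All (_< x) r → LisBound (d ∷ʳ x) (r ∷ʳ x)
LisBound-append {x} {d} {r} bound r<x t c inc t<c with IncSubseq-∷ʳ⁻ d inc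
... | inj₁ inc′ = ≤-trans (bound t c inc′ t<c) (countBelow-++ˡ c r [ x ])
... | inj₂ (t₀ , refl , inc₀ , t₀<x) = begin
  length (t₀ ∷ʳ x)        ≡⟨ length-∷ʳ t₀ ⟩
  suc (length t₀)         ≤⟨ s≤s (≤-trans (bound t₀ x inc₀ t₀<x) (countBelow≤length x r)) ⟩
  suc (length r)          ≤⟨ countBelow-through c r [] r<x (All.∷ʳ⁻ t<c .proj₂) ⟩
  countBelow c (r ∷ʳ x)   ∎
  where open ≤-Reasoning

LisBound-bump : ∀ {d} r₁ {r₂} → LisBound d (r₁ ++ y ∷ r₂) → All (y <_) r₂ → All (_< x) r₁ → x < y →
                LisBound (d ∷ʳ x) (r₁ ++ x ∷ r₂)
LisBound-bump {y} {x} {d} r₁ {r₂} bound y<r₂ r₁<x x<y t c inc t<c with IncSubseq-∷ʳ⁻ d inc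
... | inj₁ inc′ = ≤-trans (bound t c inc′ t<c) (countBelow-replace c r₁ r₂ x<y)
... | inj₂ (t₀ , refl , inc₀ , t₀<x) = begin
  length (t₀ ∷ʳ x)               ≡⟨ length-∷ʳ t₀ ⟩
  suc (length t₀)                ≤⟨ s≤s (≤-trans (bound t₀ x inc₀ t₀<x) (countBelow-cut x r₁ x≤y∷r₂)) ⟩
  suc (length r₁)                ≤⟨ countBelow-through c r₁ r₂ r₁<x (All.∷ʳ⁻ t<c .proj₂) ⟩
  countBelow c (r₁ ++ x ∷ r₂)    ∎
  where
  open ≤-Reasoning
  x≤y∷r₂ : All (x ≤_) (y ∷ r₂)
  x≤y∷r₂ = All.map <⇒≤ (x<y ∷ All.map (<-trans x<y) y<r₂)

LisWitness-extend : ∀ {d r} → LisWitness d r → ∀ r₁ {r₂} → r ≡ r₁ ++ r₂ → All (_< x) r₁ →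
                    ∃[ t ] IncSubseq t (d ∷ʳ x) × length t ≡ suc (length r₁) × All (_≤ x) t
LisWitness-extend {x} {d} witness r₁ eq r₁<x with initLast r₁
... | [] = [ x ] , (++⁺ (minimum d) ⊆-refl , [-]) , refl , ≤-refl ∷ []
... | r₀ ∷ʳ′ z with witness r₀ z _ (trans eq (++-assoc r₀ [ z ] _))
...   | t , inc , t-length , t≤z =
  t ∷ʳ x , IncSubseq-∷ʳ⁺ inc t<x , trans (length-∷ʳ t) (cong suc (trans t-length (sym (length-∷ʳ r₀)))) ,
  All.∷ʳ⁺ (All.map <⇒≤ t<x) ≤-refl
  where
  t<x : All (_< x) t
  t<x = All.map (λ w≤z → ≤-<-trans w≤z (All.∷ʳ⁻ r₁<x .proj₂)) t≤z

LisWitness-++ʳ : ∀ {d r} e → LisWitness d r → LisWitness (d ++ e) r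
LisWitness-++ʳ e witness r₁ z r₂ eq with witness r₁ z r₂ eq
... | t , inc , t-length , t≤z = t , IncSubseq-++ʳ e inc , t-length , t≤z

LisWitness-append : ∀ {d} r → LisWitness d r → All (_< x) r → LisWitness (d ∷ʳ x) (r ∷ʳ x)
LisWitness-append {x} r witness r<x q₁ z q₂ eq with ++-∷-split r q₁ eq
... | inj₁ (refl , refl , refl) = LisWitness-extend witness r (sym (++-identityʳ r)) r<x
... | inj₂ (inj₁ (m , refl , _)) = LisWitness-++ʳ [ x ] witness q₁ z m refl
... | inj₂ (inj₂ (m , _ , []≡m++z∷q₂)) = ⊥-elim (++-∷-nonempty m []≡m++z∷q₂)

LisWitness-bump : ∀ {d} r₁ {r₂} → LisWitness d (r₁ ++ y ∷ r₂) → All (_< x) r₁ → LisWitness (d ∷ʳ x) (r₁ ++ x ∷ r₂)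
LisWitness-bump {y} {x} r₁ {r₂} witness r₁<x q₁ z q₂ eq with ++-∷-split r₁ q₁ eq
... | inj₁ (refl , refl , refl) = LisWitness-extend witness r₁ refl r₁<x
... | inj₂ (inj₁ (m , refl , refl)) =
  LisWitness-++ʳ [ x ] witness q₁ z (m ++ y ∷ r₂) (++-assoc q₁ (z ∷ m) (y ∷ r₂))
... | inj₂ (inj₂ (m , refl , refl))
  with LisWitness-++ʳ [ x ] witness (r₁ ++ y ∷ m) z q₂ (sym (++-assoc r₁ (y ∷ m) (z ∷ q₂)))
...   | t , inc , t-length , t≤z = t , inc , trans t-length (cong suc (trans (length-++ r₁) (sym (length-++ r₁)))) , t≤z

-- A descent p > q of d, with p first, dominating every first-row entry up to m: if a later x
-- bumped some y ≤ m, then p q x would be a 321 pattern.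
Guarded : List ℕ → List ℕ → ℕ → Set
Guarded d r m = ∃[ p ] ∃[ q ] (p ∷ q ∷ []) ⊆ d × q < p × All (λ z → z ≤ m → z ≤ q) r

record Invariant (d r s : List ℕ) : Set where
  field
    row∈d          : All (_∈ d) r
    bumped∈d       : All (_∈ d) s
    row-sorted     : Sorted r
    bumped-sorted  : Sorted s
    last-guarded   : ∀ s₀ m → s ≡ s₀ ∷ʳ m → Guarded d r m
    lis-bound      : LisBound d r
    lis-witness    : LisWitness d r
open Invariant

invariant-[] : Invariant [] [] []
invariant-[] = record
  { row∈d = [] ; bumped∈d = [] ; row-sorted = [] ; bumped-sorted = []
  ; last-guarded = λ s₀ m → ⊥-elim ∘ ++-∷-nonempty s₀
  ; lis-bound = λ { _ _ ([] , _) _ → z≤n }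
  ; lis-witness = λ r₁ z r₂ → ⊥-elim ∘ ++-∷-nonempty r₁ }

invariant-append : ∀ {d r s} → x ∉ d → All (_≤ x) r → Invariant d r s → Invariant (d ∷ʳ x) (r ∷ʳ x) s
invariant-append {x} {d} {r} {s} x∉d r≤x inv = record
  { row∈d = All.∷ʳ⁺ (All.map (∈-++⁺ˡ) (row∈d inv)) (∈-++⁺ʳ d (here refl))
  ; bumped∈d = All.map ∈-++⁺ˡ (bumped∈d inv)
  ; row-sorted = Sorted-∷ʳ⁺ (row-sorted inv) r<x
  ; bumped-sorted = bumped-sorted inv
  ; last-guarded = guarded
  ; lis-bound = LisBound-append (lis-bound inv) r<x
  ; lis-witness = LisWitness-append r (lis-witness inv) r<x }
  where
  r<x : All (_< x) r
  r<x = ≤-∉⇒< r≤x (row∈d inv) x∉d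
  guarded : ∀ s₀ m → s ≡ s₀ ∷ʳ m → Guarded (d ∷ʳ x) (r ∷ʳ x) m
  guarded s₀ m refl with x <? m
  ... | yes x<m = m , x , ++⁺ (from∈ m∈d) ⊆-refl , x<m , All.∷ʳ⁺ (All.map (λ z≤x _ → z≤x) r≤x) (λ _ → ≤-refl)
    where m∈d = All.∷ʳ⁻ (bumped∈d inv) .proj₂
  ... | no x≮m with last-guarded inv s₀ m refl
  ...   | p , q , pq⊆d , q<p , guard = p , q , ++⁺ʳ [ x ] pq⊆d , q<p , All.∷ʳ⁺ guard x≤m-impossible
    where
    x≤m-impossible : x ≤ m → x ≤ q
    x≤m-impossible x≤m = ⊥-elim (x∉d (subst (_∈ d) (≤-antisym (≮⇒≥ x≮m) x≤m) (All.∷ʳ⁻ (bumped∈d inv) .proj₂)))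

bumped-below : ∀ {d r s} → FullyCommutative (d ∷ʳ x) → Invariant d r s → y ∈ r → x < y → All (_< y) s
bumped-below {x} {y} {d} {r} {s} fc inv y∈r x<y with initLast s
... | [] = []
... | s₀ ∷ʳ′ m = All.∷ʳ⁺ (All.map (λ z<m → <-trans z<m m<y) (Sorted-∷ʳ⁻ s₀ (bumped-sorted inv) .proj₂)) m<y
  where
  m<y : m < y
  m<y with y ≤? m
  ... | no y≰m = ≰⇒> y≰m
  ... | yes y≤m with last-guarded inv s₀ m refl
  ...   | p , q , pq⊆d , q<p , guard =
    ⊥-elim (fc (p , q , x , ++⁺ pq⊆d ⊆-refl , q<p , <-≤-trans x<y (All.lookup guard y∈r y≤m)))

invariant-bump : ∀ {d} r₁ {y r₂ s} → FullyCommutative (d ∷ʳ x) → x ∉ d → All (_≤ x) r₁ → x < y →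
                 Invariant d (r₁ ++ y ∷ r₂) s → Invariant (d ∷ʳ x) (r₁ ++ x ∷ r₂) (s ∷ʳ y)
invariant-bump {x} {d} r₁ {y} {r₂} {s} fc x∉d r₁≤x x<y inv = record
  { row∈d = All.++⁺ (All.map ∈-++⁺ˡ r₁∈d) (∈-++⁺ʳ d (here refl) ∷ All.map ∈-++⁺ˡ (All.tail y∷r₂∈d))
  ; bumped∈d = All.∷ʳ⁺ (All.map ∈-++⁺ˡ (bumped∈d inv)) (∈-++⁺ˡ (All.head y∷r₂∈d))
  ; row-sorted = Sorted-replace r₁ (row-sorted inv) r₁<x x<y
  ; bumped-sorted = Sorted-∷ʳ⁺ (bumped-sorted inv) (bumped-below fc inv (∈-++⁺ʳ r₁ (here refl)) x<y)
  ; last-guarded = guarded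
  ; lis-bound = LisBound-bump r₁ (lis-bound inv) y<r₂ r₁<x x<y
  ; lis-witness = LisWitness-bump r₁ (lis-witness inv) r₁<x }
  where
  r₁∈d = All.++⁻ˡ r₁ (row∈d inv)
  y∷r₂∈d = All.++⁻ʳ r₁ (row∈d inv)
  r₁<x = ≤-∉⇒< r₁≤x r₁∈d x∉d
  y<r₂ = Sorted-above r₁ (row-sorted inv)
  guarded : ∀ s₀ m → s ∷ʳ y ≡ s₀ ∷ʳ m → Guarded (d ∷ʳ x) (r₁ ++ x ∷ r₂) m
  guarded s₀ m eq with ∷ʳ-injective s s₀ eq
  ... | _ , refl = y , x , ++⁺ (from∈ (All.head y∷r₂∈d)) ⊆-refl , x<y ,
    All.++⁺ (All.map (λ z≤x _ → z≤x) r₁≤x) ((λ _ → ≤-refl) ∷ All.map (λ y<z z≤y → ⊥-elim (<⇒≱ y<z z≤y)) y<r₂)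

InvariantAt : List ℕ → State → Set
InvariantAt d (r , s) = Invariant d r s

invariant-step : ∀ {d} st → Admissible (d ∷ʳ x) → InvariantAt d st → InvariantAt (d ∷ʳ x) (step st x)
invariant-step {x} {d} (r , s) adm inv with rowInsert x r | rowInsertion x r
... | _ | appended r≤x = invariant-append (Admissible-∉ d adm) r≤x inv
... | _ | bumped r₁ y r₂ refl r₁≤x x<y = invariant-bump r₁ (adm .proj₂) (Admissible-∉ d adm) r₁≤x x<y inv

invariant-run : ∀ xs {d} st → Admissible (d ++ xs) → InvariantAt d st → InvariantAt (d ++ xs) (run st xs)
invariant-run [] {d} st _ inv = subst (λ d′ → InvariantAt d′ st) (sym (++-identityʳ d)) inv
invariant-run (x ∷ xs) {d} st adm inv =
  subst (λ d′ → InvariantAt d′ (run (step st x) xs)) (++-assoc d [ x ] xs)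
    (invariant-run xs (step st x) adm′ (invariant-step st (Admissible-++⁻ˡ (d ∷ʳ x) adm′) inv))
  where
  adm′ = Admissible-reassoc d [ x ] xs adm

invariant-run₀ : ∀ w → Admissible w → InvariantAt w (run₀ w)
invariant-run₀ w adm = invariant-run w ([] , []) adm invariant-[]

strict-upper-bound : ∀ xs → ∃[ c ] All (_< c) xs
strict-upper-bound [] = 0 , []
strict-upper-bound (x ∷ xs) with strict-upper-bound xs
... | c , xs<c = suc x ⊔ c , m≤m⊔n (suc x) c ∷ All.map (λ z<c → <-≤-trans z<c (m≤n⊔m (suc x) c)) xs<c

IncSubseq≤row : ∀ {d r s t} → Invariant d r s → IncSubseq t d → length t ≤ length r
IncSubseq≤row {r = r} {t = t} inv inc with strict-upper-bound t
... | c , t<c = ≤-trans (lis-bound inv t c inc t<c) (countBelow≤length c r)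

row-attained : ∀ {d r s} → Invariant d r s → ∃[ t ] IncSubseq t d × length t ≡ length r
row-attained {d} {r} inv with initLast r
... | [] = [] , (minimum d , []) , refl
... | r₀ ∷ʳ′ z with lis-witness inv r₀ z [] refl
...   | t , inc , t-length , _ = t , inc , trans t-length (sym (length-∷ʳ r₀))

-- Swapping an ascent

data Moved (stv stw : State) : Set where
  same  : stv ≡ stw → Moved stv stw
  moved : ∀ r₁ e r₂ s₁ s₂ → stv ≡ (r₁ ++ e ∷ r₂ , s₁ ++ s₂) → stw ≡ (r₁ ++ r₂ , s₁ ++ e ∷ s₂) → Moved stv stw

module _ (x : ℕ) (r₁ : List ℕ) (e : ℕ) (r₂ s₁ s₂ : List ℕ) where

  moved-bump-before : ∀ {r₁′ y} → rowInsert x r₁ ≡ (r₁′ , just y) →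
                      Moved (step (r₁ ++ e ∷ r₂ , s₁ ++ s₂) x) (step (r₁ ++ r₂ , s₁ ++ e ∷ s₂) x)
  moved-bump-before {r₁′} {y} eq = moved r₁′ e r₂ s₁ (s₂ ∷ʳ y)
    (trans (step-rowInsert (r₁ ++ e ∷ r₂) (s₁ ++ s₂) x (rowInsert-bump-++ r₁ eq))
           (cong (_ ,_) (++-assoc s₁ s₂ [ y ])))
    (trans (step-rowInsert (r₁ ++ r₂) (s₁ ++ e ∷ s₂) x (rowInsert-bump-++ r₁ eq))
           (cong (_ ,_) (++-assoc s₁ (e ∷ s₂) [ y ])))

  moved-pass : All (_≤ x) r₁ → e ≤ x →
               Moved (step (r₁ ++ e ∷ r₂ , s₁ ++ s₂) x) (step (r₁ ++ r₂ , s₁ ++ e ∷ s₂) x)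
  moved-pass r₁≤x e≤x = moved r₁ e (proj₁ ρ) s₁ (push s₂ (proj₂ ρ)) v-step w-step
    where
    ρ = rowInsert x r₂
    v-step : step (r₁ ++ e ∷ r₂ , s₁ ++ s₂) x ≡ (r₁ ++ e ∷ proj₁ ρ , s₁ ++ push s₂ (proj₂ ρ))
    v-step = trans (step-rowInsert (r₁ ++ e ∷ r₂) (s₁ ++ s₂) x
                     (trans (cong (rowInsert x) (sym (++-assoc r₁ [ e ] r₂)))
                            (rowInsert-skip (r₁ ∷ʳ e) (All.∷ʳ⁺ r₁≤x e≤x))))
                   (cong₂ _,_ (++-assoc r₁ [ e ] (proj₁ ρ)) (push-++ s₁ s₂ (proj₂ ρ)))
    w-step : step (r₁ ++ r₂ , s₁ ++ e ∷ s₂) x ≡ (r₁ ++ proj₁ ρ , s₁ ++ e ∷ push s₂ (proj₂ ρ))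
    w-step = trans (step-rowInsert (r₁ ++ r₂) (s₁ ++ e ∷ s₂) x (rowInsert-skip r₁ r₁≤x))
                   (cong (_ ,_) (trans (push-++ s₁ (e ∷ s₂) (proj₂ ρ)) (cong (s₁ ++_) (push-++ [ e ] s₂ (proj₂ ρ)))))

moved-bump-moved : ∀ x r₁ e r₂ s₁ → All (_≤ x) r₁ → x < e → All (e <_) r₂ →
                   Moved (step (r₁ ++ e ∷ r₂ , s₁ ++ []) x) (step (r₁ ++ r₂ , s₁ ∷ʳ e) x)
moved-bump-moved x r₁ e [] s₁ r₁≤x x<e _ = same (begin
  step (r₁ ++ [ e ] , s₁ ++ []) x   ≡⟨ step-rowInsert (r₁ ++ [ e ]) (s₁ ++ []) x (rowInsert-bump r₁ r₁≤x x<e) ⟩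
  (r₁ ∷ʳ x , (s₁ ++ []) ∷ʳ e)       ≡⟨ cong (λ s → (r₁ ∷ʳ x , s ∷ʳ e)) (++-identityʳ s₁) ⟩
  (r₁ ∷ʳ x , s₁ ∷ʳ e)               ≡⟨ step-rowInsert (r₁ ++ []) (s₁ ∷ʳ e) x (rowInsert-skip r₁ r₁≤x) ⟨
  step (r₁ ++ [] , s₁ ∷ʳ e) x       ∎)
  where open ≡-Reasoning
moved-bump-moved x r₁ e (h ∷ r₂) s₁ r₁≤x x<e (e<h ∷ _) = moved (r₁ ∷ʳ x) h r₂ (s₁ ∷ʳ e) []
  (trans (step-rowInsert (r₁ ++ e ∷ h ∷ r₂) (s₁ ++ []) x (rowInsert-bump r₁ r₁≤x x<e))
         (cong₂ _,_ (sym (++-assoc r₁ [ x ] (h ∷ r₂)))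
                    (trans (cong (_∷ʳ e) (++-identityʳ s₁)) (sym (++-identityʳ (s₁ ∷ʳ e))))))
  (trans (step-rowInsert (r₁ ++ h ∷ r₂) (s₁ ∷ʳ e) x (rowInsert-bump r₁ r₁≤x (<-trans x<e e<h)))
         (cong (_, _) (sym (++-assoc r₁ [ x ] r₂))))

no-bumped-after : ∀ s₁ s₂ → Sorted (s₁ ++ x ∷ s₂) → Sorted ((s₁ ++ s₂) ∷ʳ x) → s₂ ≡ []
no-bumped-after s₁ [] _ _ = refl
no-bumped-after s₁ (h ∷ s₂) sorted sorted′ = ⊥-elim (<-asym (All.head (Sorted-above s₁ sorted)) h<x)
  where
  h<x = All.head (All.++⁻ʳ s₁ (Sorted-∷ʳ⁻ (s₁ ++ h ∷ s₂) sorted′ .proj₂))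

moved-step : ∀ x {stv stw} → Sorted (proj₁ stv) → Sorted (proj₂ stw) → Sorted (proj₂ (step stv x)) →
             Moved stv stw → Moved (step stv x) (step stw x)
moved-step x _ _ _ (same refl) = same refl
moved-step x row-sorted bumped-sorted bumped-sorted′ (moved r₁ e r₂ s₁ s₂ refl refl)
  with rowInsert x r₁ in eq | rowInsertion x r₁
... | _ | bumped _ _ _ _ _ _ = moved-bump-before x r₁ e r₂ s₁ s₂ eq
... | _ | appended r₁≤x with x <? e
...   | no x≮e = moved-pass x r₁ e r₂ s₁ s₂ r₁≤x (≮⇒≥ x≮e)
...   | yes x<e
  with no-bumped-after s₁ s₂ bumped-sorted
         (subst (Sorted ∘ proj₂) (step-rowInsert (r₁ ++ e ∷ r₂) (s₁ ++ s₂) x (rowInsert-bump r₁ r₁≤x x<e))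
                bumped-sorted′)
...     | refl = moved-bump-moved x r₁ e r₂ s₁ r₁≤x x<e (Sorted-above r₁ row-sorted)

moved-run : ∀ xs {dv dw} stv stw → Admissible (dv ++ xs) → Admissible (dw ++ xs) →
            InvariantAt dv stv → InvariantAt dw stw → Moved stv stw → Moved (run stv xs) (run stw xs)
moved-run [] _ _ _ _ _ _ stv↝stw = stv↝stw
moved-run (x ∷ xs) {dv} {dw} stv stw admv admw invv invw stv↝stw =
  moved-run xs (step stv x) (step stw x) admv′ admw′ invv′ invw′
    (moved-step x (row-sorted invv) (bumped-sorted invw) (bumped-sorted invv′) stv↝stw)
  where
  admv′ = Admissible-reassoc dv [ x ] xs admv
  admw′ = Admissible-reassoc dw [ x ] xs admw
  invv′ = invariant-step stv (Admissible-++⁻ˡ (dv ∷ʳ x) admv′) invv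
  invw′ = invariant-step stw (Admissible-++⁻ˡ (dw ∷ʳ x) admw′) invw

moved-ascent : ∀ {a b} R S → a < b → All (_≤ b) R →
               Moved (step (step (R , S) a) b) (step (step (R , S) b) a)
moved-ascent {a} {b} R S a<b R≤b with rowInsert a R | rowInsertion a R
... | _ | bumped p₁ c p₂ refl p₁≤a a<c = same (begin
  step (R′ , S ∷ʳ c) b                 ≡⟨ step-rowInsert R′ (S ∷ʳ c) b (rowInsert-append R′≤b) ⟩
  (R′ ∷ʳ b , S ∷ʳ c)                   ≡⟨ step-rowInsert (R ∷ʳ b) S a (rowInsert-bump-++ R (rowInsert-bump p₁ p₁≤a a<c)) ⟨
  step (R ∷ʳ b , S) a                  ≡⟨ cong (λ st → step st a) (step-rowInsert R S b (rowInsert-append R≤b)) ⟨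
  step (step (R , S) b) a              ∎)
  where
  open ≡-Reasoning
  R′ = p₁ ++ a ∷ p₂
  R′≤b : All (_≤ b) R′
  R′≤b = All.++⁺ (All.++⁻ˡ p₁ R≤b) (<⇒≤ a<b ∷ All.tail (All.++⁻ʳ p₁ R≤b))
... | _ | appended R≤a = moved (R ∷ʳ a) b [] S []
  (trans (step-rowInsert (R ∷ʳ a) S b (rowInsert-append (All.∷ʳ⁺ R≤b (<⇒≤ a<b))))
         (cong (_ ,_) (sym (++-identityʳ S))))
  (trans (cong (λ st → step st a) (step-rowInsert R S b (rowInsert-append R≤b)))
         (trans (step-rowInsert (R ∷ʳ b) S a (rowInsert-bump R R≤a a<b))
                (cong (_, _) (sym (++-identityʳ (R ∷ʳ a))))))

moved-swap : ∀ α {a b} β → a < b → Admissible (α ++ a ∷ b ∷ β) → Admissible (α ++ b ∷ a ∷ β) →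
             Moved (run₀ (α ++ a ∷ b ∷ β)) (run₀ (α ++ b ∷ a ∷ β))
moved-swap α {a} {b} β a<b admv admw =
  subst₂ Moved (sym (foldl-++ step ([] , []) α (a ∷ b ∷ β))) (sym (foldl-++ step ([] , []) α (b ∷ a ∷ β)))
    (moved-run β (run (run₀ α) (a ∷ b ∷ [])) (run (run₀ α) (b ∷ a ∷ [])) admv′ admw′
      (invariant-run (a ∷ b ∷ []) (run₀ α) (Admissible-++⁻ˡ _ admv′) invα)
      (invariant-run (b ∷ a ∷ []) (run₀ α) (Admissible-++⁻ˡ _ admw′) invα)
      (moved-ascent (proj₁ (run₀ α)) (proj₂ (run₀ α)) a<b
        (All.map (prefix-below-descent α β a<b (admw .proj₂)) (row∈d invα))))
  where
  admv′ = Admissible-reassoc α (a ∷ b ∷ []) β admv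
  admw′ = Admissible-reassoc α (b ∷ a ∷ []) β admw
  invα = invariant-run₀ α (Admissible-++⁻ˡ α admv)

module SwapAscent (α : List ℕ) {a b : ℕ} (β : List ℕ) (a<b : a < b)
                  (admv : Admissible (α ++ a ∷ b ∷ β)) (admw : Admissible (α ++ b ∷ a ∷ β)) where

  v w : List ℕ
  v = α ++ a ∷ b ∷ β
  w = α ++ b ∷ a ∷ β

  invv : InvariantAt v (run₀ v)
  invv = invariant-run₀ v admv

  invw : InvariantAt w (run₀ w)
  invw = invariant-run₀ w admw

  BothUsed : Set
  BothUsed = ∀ s → LongestIncSubseq s v → a ∈ s × b ∈ s

  equal-tableaux : run₀ v ≡ run₀ w → P v ≡ P w
  equal-tableaux eq = trans (P-run₀ α a (b ∷ β)) (trans (cong toTableau eq) (sym (P-run₀ α b (a ∷ β))))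

  equal⇒not-both-used : run₀ v ≡ run₀ w → ¬ BothUsed
  equal⇒not-both-used eq both with row-attained invw
  ... | t , inc , t-length with both t (IncSubseq-unswap α β a<b inc , longest)
    where
    longest : ∀ u → IncSubseq u v → length u ≤ length t
    longest u inc-u = ≤-trans (IncSubseq≤row invv inc-u) (≤-reflexive (trans (cong (length ∘ proj₁) eq) (sym t-length)))
  ... | a∈t , b∈t = IncSubseq-swapped-exclusive α β a<b (admw .proj₁) inc a∈t b∈t

  module _ (longer : length (proj₁ (run₀ v)) ≡ suc (length (proj₁ (run₀ w)))) where

    longer⇒distinct : P v ≢ P w
    longer⇒distinct P≡ = 1+n≢n (trans (sym longer) (cong length rows≡))
      where
      rows≡ : proj₁ (run₀ v) ≡ proj₁ (run₀ w)
      rows≡ = ∷-injectiveˡ (trans (sym (P-run₀ α a (b ∷ β))) (trans P≡ (P-run₀ α b (a ∷ β))))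

    longer⇒both-used : BothUsed
    longer⇒both-used s ((s⊆v , inc) , longest) with ⊆-unswap α β s⊆v
    ... | inj₁ (s₁ , s₂ , refl) = ∈-++⁺ʳ s₁ (here refl) , ∈-++⁺ʳ s₁ (there (here refl))
    ... | inj₂ s⊆w with row-attained invv
    ...   | t , inc-t , t-length = ⊥-elim (1+n≰n (begin
      suc (length (proj₁ (run₀ w)))   ≡⟨ longer ⟨
      length (proj₁ (run₀ v))         ≡⟨ t-length ⟨
      length t                        ≤⟨ longest t inc-t ⟩
      length s                        ≤⟨ IncSubseq≤row invw (s⊆w , inc) ⟩
      length (proj₁ (run₀ w))         ∎))
      where open ≤-Reasoning

  Row₂-growth : length (proj₂ (run₀ w)) ≡ suc (length (proj₂ (run₀ v))) →
                length (Row₂ (P w)) ≡ suc (length (Row₂ (P v)))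
  Row₂-growth longer = begin
    length (Row₂ (P w))                   ≡⟨ cong (length ∘ Row₂) (P-run₀ α b (a ∷ β)) ⟩
    length (Row₂ (toTableau (run₀ w)))    ≡⟨ cong length (Row₂-toTableau _ _ (bumped-sorted invw)) ⟩
    length (proj₂ (run₀ w))               ≡⟨ longer ⟩
    suc (length (proj₂ (run₀ v)))         ≡⟨ cong (suc ∘ length) (Row₂-toTableau _ _ (bumped-sorted invv)) ⟨
    suc (length (Row₂ (toTableau (run₀ v)))) ≡⟨ cong (suc ∘ length ∘ Row₂) (P-run₀ α a (b ∷ β)) ⟨
    suc (length (Row₂ (P v)))             ∎
    where open ≡-Reasoning

  swap-ascent : ((P v ≢ P w) ⇔ BothUsed) × (P v ≢ P w → length (Row₂ (P w)) ≡ suc (length (Row₂ (P v))))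
  swap-ascent with moved-swap α β a<b admv admw
  ... | same eq = mk⇔ (λ distinct → ⊥-elim (distinct (equal-tableaux eq))) (⊥-elim ∘ equal⇒not-both-used eq) ,
                  (λ distinct → ⊥-elim (distinct (equal-tableaux eq)))
  ... | moved r₁ e r₂ s₁ s₂ eqv eqw =
    mk⇔ (λ _ → longer⇒both-used row-longer) (λ _ → longer⇒distinct row-longer) , λ _ → Row₂-growth bumped-longer
    where
    row-longer : length (proj₁ (run₀ v)) ≡ suc (length (proj₁ (run₀ w)))
    row-longer = trans (cong (length ∘ proj₁) eqv)
                       (trans (length-++-sucʳ r₁ e r₂) (cong (suc ∘ length ∘ proj₁) (sym eqw)))
    bumped-longer : length (proj₂ (run₀ w)) ≡ suc (length (proj₂ (run₀ v)))
    bumped-longer = trans (cong (length ∘ proj₂) eqw)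
                          (trans (length-++-sucʳ s₁ e s₂) (cong (suc ∘ length ∘ proj₂) (sym eqv)))

swapAt-split : ∀ i v → suc i < length v →
  ∃[ α ] ∃[ a ] ∃[ b ] ∃[ β ] v ≡ α ++ a ∷ b ∷ β × swapAt i v ≡ α ++ b ∷ a ∷ β × v ! i ≡ a × v ! suc i ≡ b
swapAt-split zero (_ ∷ []) (s≤s ())
swapAt-split zero (a ∷ b ∷ β) _ = [] , a , b , β , refl , refl , refl , refl
swapAt-split (suc i) (x ∷ v) (s≤s i+1<len) with swapAt-split i v i+1<len
... | α , a , b , β , refl , eq , vi≡a , vi+1≡b = x ∷ α , a , b , β , refl , cong (x ∷_) eq , vi≡a , vi+1≡b

IsPerm⇒Unique : ∀ v → IsPerm v → Unique v
IsPerm⇒Unique v v↭ = Unique-resp-↭ (↭⇒↭ₛ (↭-sym v↭)) (upTo⁺ (length v))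

corollary3p6 : (v w : List ℕ) (i : ℕ) → IsPerm v → IsPerm w → FullyCommutative v → FullyCommutative w → suc i < length v → w ≡ swapAt i v → len w ≡ suc (len v) → ((P v ≢ P w) ⇔ (∀ s → LongestIncSubseq s v → (v ! i) ∈ s × (v ! suc i) ∈ s)) × (P v ≢ P w → length (Row₂ (P w)) ≡ suc (length (Row₂ (P v))))
corollary3p6 v .(swapAt i v) i perm-v perm-w fc-v fc-w i+1<len refl len-w with swapAt-split i v i+1<len
... | α , a , b , β , refl , swapped , vᵢ≡a , vᵢ₊₁≡b rewrite swapped | vᵢ≡a | vᵢ₊₁≡b =
  SwapAscent.swap-ascent α β (len-swap-ascent α β len-w)
    (IsPerm⇒Unique _ perm-v , fc-v) (IsPerm⇒Unique _ perm-w , fc-w)
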